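{- Let $P : A \to \mathsf{Prop}$ and $Q : B \to \mathsf{Prop}$ be predicates. Then $\mathcal{O}_P \le \mathcal{O}_Q$ if and only if $\forall a{:}A.\; \mathcal{O}_Q(P\,a)$.
   Context: We work in the Calculus of Inductive Constructions with an impredicative universe $\mathsf{Prop}$ of proof-irrelevant propositions, together with function extensionality, propositional extensionality, uniqueness of proofs of propositions, and definite description. A modality is a monotone, inflationary, idempotent map $j : \mathsf{Prop} \to \mathsf{Prop}$; modalities are ordered pointwise ($j \le k$ iff $\forall p.\, j\,p\Rightarrow k\,p$). For $P : A \to \mathsf{Prop}$, the oracle modality $\mathcal{O}_P$ is defined at $s:\mathsf{Prop}$ as the inductive proposition with constructors $\mathsf{prf} : s \to \mathcal{O}_P\,s$ and $\mathsf{ask} : \prod_{a:A} (P\,a \to \mathcal{O}_P\,s) \to \mathcal{O}_P\,s$; equivalently $\mathcal{O}_P\,s \iff \forall r{:}\mathsf{Prop}.\,(s\Rightarrow r)\Rightarrow(\forall a{:}A.\,(P\,a\Rightarrow r)\Rightarrow r)\Rightarrow r$. -}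

module Defs where


-- Propositions are rendered as types in Set (propositions-as-types);
-- the oracle modality O_P as the inductive family from the paper.
data O {A : Set} (P : A → Set) (s : Set) : Set where
  prf : s → O P s
  ask : (a : A) → (P a → O P s) → O P s

_≤ₘ_ : (Set → Set) → (Set → Set) → Set₁
j ≤ₘ k = (p : Set) → j p → k p

module Submission where

open import Defs
open import Function.Bundles using (_⇔_; mk⇔)

-- O P is the free monad on the oracle signature: ask a queries P a. Asking a and
-- returning the answer gives O P (P a); conversely a run of O P can be replayed in
-- O Q by substituting each query a with a Q-computation of P a.

module _ {A : Set} {P : A → Set} where

  O-bind : {s t : Set} → O P s → (s → O P t) → O P t
  O-bind (prf x)   k = k x
  O-bind (ask a f) k = ask a (λ p → O-bind (f p) k)

  O-query : (a : A) → O P (P a)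
  O-query a = ask a prf

O-interpret : {A B : Set} {P : A → Set} {Q : B → Set} →
  ((a : A) → O Q (P a)) → O P ≤ₘ O Q
O-interpret answer s (prf x)   = prf x
O-interpret answer s (ask a f) = O-bind (answer a) (λ p → O-interpret answer s (f p))

corollary7 : {A B : Set} (P : A → Set) (Q : B → Set) →
    (O P ≤ₘ O Q) ⇔ ((a : A) → O Q (P a))
corollary7 P Q = mk⇔ (λ P≤Q a → P≤Q (P a) (O-query a)) O-interpret
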